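{- For $0\le k\le n$, $D(n,k)-\widetilde{D}(n,k)=(-1)^k\binom{n}{k}$.
   Context: $\mathcal{B}_n$ is the group of permutations $\sigma$ of $\{ -n,\dots,n\}$ with $\sigma(-k)=-\sigma(k)$ for all $k$. For $\sigma\in\mathcal{B}_n$, $\mathrm{desc}(\sigma)$ is the number of $i\in\{0,\dots,n-1\}$ with $\sigma(i)>\sigma(i+1)$ (descends of $(0,\sigma(1),\dots,\sigma(n))$). $\mathcal{D}_n$ is the set of $\sigma\in\mathcal{B}_n$ such that $\{\sigma(1),\dots,\sigma(n)\}$ contains an even number of negative elements, and $\widetilde{\mathcal{D}}_n=\mathcal{B}_n\setminus\mathcal{D}_n$. $D(n,k)=\#\{\sigma\in\mathcal{D}_n:\mathrm{desc}(\sigma)=k\}$ and $\widetilde{D}(n,k)=\#\{\sigma\in\widetilde{\mathcal{D}}_n:\mathrm{desc}(\sigma)=k\}$. -}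

module Defs where

open import Data.Bool using (Bool; true; false; _∧_; not)
open import Data.Nat using (ℕ; zero; suc; _≡ᵇ_)
open import Data.Integer using (ℤ; +_; -[1+_]; ∣_∣; _<?_)
open import Data.List using (List; []; _∷_; map; concatMap; upTo; length; filterᵇ)
open import Relation.Nullary.Decidable using (⌊_⌋)

_<ᵇ_ : ℤ → ℤ → Bool
infix 4 _<ᵇ_
x <ᵇ y = ⌊ x <? y ⌋

allᵇ : (ℤ → Bool) → List ℤ → Bool
allᵇ p []       = true
allᵇ p (x ∷ xs) = p x ∧ allᵇ p xs

-- A signed permutation σ ∈ B_n is determined by its one-line notation
-- (σ(1), …, σ(n)) ∈ ℤⁿ (σ(0) = 0 and σ(-i) = -σ(i) are forced).

signedValues : ℕ → List ℤ
signedValues n = concatMap (λ i → + suc i ∷ -[1+ i ] ∷ []) (upTo n)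

words : ℕ → List ℤ → List (List ℤ)
words zero    A = [] ∷ []
words (suc m) A = concatMap (λ a → map (a ∷_) (words m A)) A

distinctAbs : List ℤ → Bool
distinctAbs []       = true
distinctAbs (x ∷ xs) = allᵇ (λ y → not (∣ x ∣ ≡ᵇ ∣ y ∣)) xs ∧ distinctAbs xs

B : ℕ → List (List ℤ)
B n = filterᵇ distinctAbs (words n (signedValues n))

descList : ℤ → List ℤ → ℕ
descList a []       = 0
descList a (b ∷ bs) with b <ᵇ a
... | true  = suc (descList b bs)
... | false = descList b bs

desc : List ℤ → ℕ
desc σ = descList (+ 0) σ

negCount : List ℤ → ℕ
negCount [] = 0
negCount (x ∷ xs) with x <ᵇ + 0
... | true  = suc (negCount xs)
... | false = negCount xs

isEven : ℕ → Bool
isEven zero          = true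
isEven (suc zero)    = false
isEven (suc (suc n)) = isEven n

Dcount : ℕ → ℕ → ℕ
Dcount n k = length (filterᵇ (λ σ → isEven (negCount σ) ∧ (desc σ ≡ᵇ k)) (B n))

Dtcount : ℕ → ℕ → ℕ
Dtcount n k = length (filterᵇ (λ σ → not (isEven (negCount σ)) ∧ (desc σ ≡ᵇ k)) (B n))

module Submission where

-- D(n,k) − D̃(n,k) = Σ_{σ ∈ Bₙ, desc σ = k} sign σ, where sign σ = ±1 according
-- to the parity of the number of negative entries; we show this signed sum is
-- (−1)ᵏ·C(n,k).
--
-- The signed sum is computed letter by letter.  Generalise it to T(u, a, m, k)
-- (signedCount below): the signed number of words of length m over ±1, …, ±n
-- with distinct absolute values avoiding a set u of used values, having k
-- descents when preceded by a letter a whose absolute value is used (or 0).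
-- Expanding along the first letter, the letters +j and −j contribute the same
-- remaining sum with opposite signs, and differ only in whether they form a
-- descent after a.  Hence, by induction on m, T(u, a, m, k) = (−1)ᵏ·C(m,k) if
-- |a| lies below every unused value, and 0 otherwise: the pair ±j cancels
-- unless j is the least unused value, and then it yields Pascal's rule when
-- |a| < j, and 0 when j < |a|.

open import Defs
open import Data.Nat using (ℕ; _≤_)
open import Data.Nat.Combinatorics using (_C_)
open import Data.Integer using (ℤ; +_; -[1+_]; _-_; _*_; _^_)
open import Relation.Binary.PropositionalEquality using (_≡_)

open import Data.Bool using (Bool; true; false; _∧_; _∨_; not; if_then_else_; T)
open import Data.Bool.Properties using (∧-zeroʳ; ∨-zeroʳ; T-≡; T-not-≡)
open import Data.Nat using (zero; suc; _<_; _≡ᵇ_; _≤ᵇ_; z≤n; s≤s)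
import Data.Nat as ℕ
open import Data.Nat.Properties
  using (≤ᵇ⇒≤; ≤⇒≤ᵇ; ≡⇒≡ᵇ; ≡ᵇ⇒≡; ≰⇒>; ≤∧≢⇒<; ≤-<-trans; <-asym; ≤-reflexive; suc-injective; +-suc)
open import Data.Nat.Combinatorics using (nCk+nC[k+1]≡[n+1]C[k+1])
open import Data.Integer using (_+_; -_; ∣_∣)
import Data.Integer as ℤ
open import Data.Integer.Properties
  using (+-identityˡ; +-assoc; +-inverseʳ; *-identityˡ; *-zeroʳ; *-assoc; *-distribˡ-+; *-distribʳ-+; neg-distribʳ-*; pos-+)
open import Data.Integer.Tactic.RingSolver using (solve-∀)
open import Data.List using (List; []; _∷_; map; concatMap; applyUpTo; upTo; length; filterᵇ; _++_)
open import Data.Product using (_×_; _,_; proj₁; proj₂; ∃-syntax)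
open import Function using (_∘_)
open import Function.Bundles using (Equivalence)
open import Relation.Binary.PropositionalEquality using (refl; sym; trans; cong; cong₂; subst; module ≡-Reasoning)
open import Relation.Nullary using (¬_)
open import Relation.Nullary.Decidable using (fromWitness; fromWitnessFalse)

open Equivalence using (to; from)
open ≡-Reasoning

sumL : {A : Set} → (A → ℤ) → List A → ℤ
sumL f []       = + 0
sumL f (x ∷ xs) = f x + sumL f xs

sumL-++ : {A : Set} (f : A → ℤ) (xs ys : List A) → sumL f (xs ++ ys) ≡ sumL f xs + sumL f ys
sumL-++ f []       ys = sym (+-identityˡ _)
sumL-++ f (x ∷ xs) ys = trans (cong (_+_ (f x)) (sumL-++ f xs ys)) (sym (+-assoc (f x) _ _))

sumL-concatMap : {A B : Set} (f : B → ℤ) (g : A → List B) (xs : List A) →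
  sumL f (concatMap g xs) ≡ sumL (λ x → sumL f (g x)) xs
sumL-concatMap f g []       = refl
sumL-concatMap f g (x ∷ xs) = trans (sumL-++ f (g x) _) (cong (_+_ (sumL f (g x))) (sumL-concatMap f g xs))

sumL-map : {A B : Set} (f : B → ℤ) (h : A → B) (xs : List A) → sumL f (map h xs) ≡ sumL (f ∘ h) xs
sumL-map f h []       = refl
sumL-map f h (x ∷ xs) = cong (_+_ (f (h x))) (sumL-map f h xs)

sumL-cong : {A : Set} {f g : A → ℤ} → (∀ x → f x ≡ g x) → (xs : List A) → sumL f xs ≡ sumL g xs
sumL-cong f≗g []       = refl
sumL-cong f≗g (x ∷ xs) = cong₂ _+_ (f≗g x) (sumL-cong f≗g xs)

sumL-zero : {A : Set} (xs : List A) → sumL (λ _ → + 0) xs ≡ + 0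
sumL-zero []       = refl
sumL-zero (x ∷ xs) = trans (+-identityˡ _) (sumL-zero xs)

sumL-scale : {A : Set} (s : ℤ) (f : A → ℤ) (xs : List A) → sumL (λ x → s * f x) xs ≡ s * sumL f xs
sumL-scale s f []       = sym (*-zeroʳ s)
sumL-scale s f (x ∷ xs) = trans (cong (_+_ (s * f x)) (sumL-scale s f xs)) (sym (*-distribˡ-+ s (f x) _))

sumL-filter : {A : Set} (f : A → ℤ) (d : A → Bool) (xs : List A) →
  sumL f (filterᵇ d xs) ≡ sumL (λ x → if d x then f x else + 0) xs
sumL-filter f d []       = refl
sumL-filter f d (x ∷ xs) with d x
... | true  = cong (_+_ (f x)) (sumL-filter f d xs)
... | false = trans (sumL-filter f d xs) (sym (+-identityˡ _))

sumN : ℕ → (ℕ → ℤ) → ℤ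
sumN zero    f = + 0
sumN (suc N) f = f 0 + sumN N (f ∘ suc)

sumL-applyUpTo : (f : ℕ → ℤ) (g : ℕ → ℕ) (N : ℕ) → sumL f (applyUpTo g N) ≡ sumN N (f ∘ g)
sumL-applyUpTo f g zero    = refl
sumL-applyUpTo f g (suc N) = cong (_+_ (f (g 0))) (sumL-applyUpTo f (g ∘ suc) N)

sumN-cong : (N : ℕ) {f g : ℕ → ℤ} → (∀ i → i < N → f i ≡ g i) → sumN N f ≡ sumN N g
sumN-cong zero    f≗g = refl
sumN-cong (suc N) f≗g = cong₂ _+_ (f≗g 0 (s≤s z≤n)) (sumN-cong N (λ i i<N → f≗g (suc i) (s≤s i<N)))

sumN-zero : (N : ℕ) → sumN N (λ _ → + 0) ≡ + 0
sumN-zero zero    = refl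
sumN-zero (suc N) = trans (+-identityˡ _) (sumN-zero N)

sumN-scale : (N : ℕ) (f : ℕ → ℤ) (s : ℤ) → sumN N (λ i → f i * s) ≡ sumN N f * s
sumN-scale zero    f s = refl
sumN-scale (suc N) f s = trans (cong (_+_ (f 0 * s)) (sumN-scale N (f ∘ suc) s)) (sym (*-distribʳ-+ s (f 0) _))

ind : Bool → ℤ
ind true  = + 1
ind false = + 0

signOf : Bool → ℤ
signOf true  = + 1
signOf false = -[1+ 0 ]

signOf-not : ∀ b → signOf (not b) ≡ -[1+ 0 ] * signOf b
signOf-not true  = refl
signOf-not false = refl

boolCases : {P : Set} (b : Bool) → (b ≡ true → P) → (b ≡ false → P) → P
boolCases true  ifTrue ifFalse = ifTrue refl
boolCases false ifTrue ifFalse = ifFalse refl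

module _ {A : Set} (p q : A → Bool) where

  countWith countWithout : List A → ℤ
  countWith    xs = + length (filterᵇ (λ x → p x ∧ q x) xs)
  countWithout xs = + length (filterᵇ (λ x → not (p x) ∧ q x) xs)

  countDifference : (xs : List A) → countWith xs - countWithout xs ≡ sumL (λ x → signOf (p x) * ind (q x)) xs
  countDifference [] = refl
  countDifference (x ∷ xs) with p x | q x | countDifference xs
  ... | true  | true  | ih = trans (+-assoc (+ 1) (countWith xs) (- countWithout xs)) (cong (_+_ (+ 1)) ih)
  ... | true  | false | ih = trans ih (sym (+-identityˡ _))
  ... | false | true  | ih = trans (one-more-negative (countWith xs) (countWithout xs)) (cong (_+_ (-[1+ 0 ])) ih)
    where
    one-more-negative : ∀ d e → d - (+ 1 + e) ≡ -[1+ 0 ] + (d - e)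
    one-more-negative = solve-∀
  ... | false | false | ih = trans ih (sym (+-identityˡ _))

-- A descent shifts the descent count by one: shift true f k = f (k − 1),
-- read as 0 for k = 0.

shift : Bool → (ℕ → ℤ) → ℕ → ℤ
shift false f k       = f k
shift true  f zero    = + 0
shift true  f (suc k) = f k

shift-cong : (β : Bool) {f g : ℕ → ℤ} → (∀ k → f k ≡ g k) → (k : ℕ) → shift β f k ≡ shift β g k
shift-cong false f≗g k       = f≗g k
shift-cong true  f≗g zero    = refl
shift-cong true  f≗g (suc k) = f≗g k

shift-scale : (β : Bool) (s : ℤ) (f : ℕ → ℤ) (k : ℕ) → shift β (λ j → s * f j) k ≡ s * shift β f k
shift-scale false s f k       = refl
shift-scale true  s f zero    = sym (*-zeroʳ s)
shift-scale true  s f (suc k) = refl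

shift-sumL : {A : Set} (β : Bool) (G : ℕ → A → ℤ) (xs : List A) (k : ℕ) →
  sumL (λ x → shift β (λ j → G j x) k) xs ≡ shift β (λ j → sumL (G j) xs) k
shift-sumL false G xs k       = refl
shift-sumL true  G xs zero    = sumL-zero xs
shift-sumL true  G xs (suc k) = refl

-- The difference between the letter +j (shift β⁺) and the letter −j (shift β⁻).
descentDiff : Bool → Bool → (ℕ → ℤ) → ℕ → ℤ
descentDiff β⁺ β⁻ f k = shift β⁺ f k - shift β⁻ f k

descentDiff-same : (β : Bool) (f : ℕ → ℤ) (k : ℕ) → descentDiff β β f k ≡ + 0
descentDiff-same β f k = +-inverseʳ (shift β f k)

descentDiff-scale : (β⁺ β⁻ : Bool) (s : ℤ) (f : ℕ → ℤ) (k : ℕ) →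
  shift β⁺ (λ j → s * f j) k - shift β⁻ (λ j → s * f j) k ≡ s * descentDiff β⁺ β⁻ f k
descentDiff-scale β⁺ β⁻ s f k = begin
  shift β⁺ (λ j → s * f j) k - shift β⁻ (λ j → s * f j) k
    ≡⟨ cong₂ _-_ (shift-scale β⁺ s f k) (shift-scale β⁻ s f k) ⟩
  s * shift β⁺ f k + - (s * shift β⁻ f k)
    ≡⟨ cong (_+_ (s * shift β⁺ f k)) (neg-distribʳ-* s (shift β⁻ f k)) ⟩
  s * shift β⁺ f k + s * - shift β⁻ f k
    ≡⟨ *-distribˡ-+ s (shift β⁺ f k) _ ⟨
  s * descentDiff β⁺ β⁻ f k ∎

-- The signed binomial coefficients (−1)ᵏ·C(m,k) obey Pascal's rule in the form
-- "no descent minus descent": c(m,k) − c(m,k−1) = c(m+1,k).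

signedBinomial : ℕ → ℕ → ℤ
signedBinomial m k = (-[1+ 0 ] ^ k) * + (m C k)

signedPascal : ∀ m k → descentDiff false true (signedBinomial m) k ≡ signedBinomial (suc m) k
signedPascal m zero    = refl
signedPascal m (suc k) = begin
  e' * + (m C suc k) - e * + (m C k)      ≡⟨ regroup e (+ (m C k)) (+ (m C suc k)) ⟩
  e' * (+ (m C k) + + (m C suc k))       ≡⟨ cong (e' *_) (pos-+ (m C k) (m C suc k)) ⟨
  e' * + (m C k ℕ.+ m C suc k)           ≡⟨ cong (λ x → e' * + x) (nCk+nC[k+1]≡[n+1]C[k+1] m k) ⟩
  e' * + (suc m C suc k)                 ∎
  where
  e e' : ℤ
  e  = -[1+ 0 ] ^ k
  e' = -[1+ 0 ] ^ suc k
  regroup : ∀ x P Q → (-[1+ 0 ] * x) * Q - x * P ≡ (-[1+ 0 ] * x) * (P + Q)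
  regroup = solve-∀

<ᵇ-true : ∀ {x y} → x ℤ.< y → (x <ᵇ y) ≡ true
<ᵇ-true x<y = to T-≡ (fromWitness x<y)

<ᵇ-false : ∀ {x y} → ¬ x ℤ.< y → (x <ᵇ y) ≡ false
<ᵇ-false x≮y = to T-not-≡ (fromWitnessFalse x≮y)

ascentDescent : ∀ a i → ∣ a ∣ < suc i → (+ suc i <ᵇ a) ≡ false × (-[1+ i ] <ᵇ a) ≡ true
ascentDescent (+ x)    i x<1+i     = <ᵇ-false (λ { (ℤ.+<+ 1+i<x) → <-asym x<1+i 1+i<x }) , refl
ascentDescent -[1+ x ] i (s≤s x<i) = refl , <ᵇ-true (ℤ.-<- x<i)

sameSide : ∀ a i → suc i < ∣ a ∣ → (+ suc i <ᵇ a) ≡ (-[1+ i ] <ᵇ a)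
sameSide (+ x)    i 1+i<x     = <ᵇ-true (ℤ.+<+ 1+i<x)
sameSide -[1+ x ] i (s≤s i<x) = sym (<ᵇ-false (λ { (ℤ.-<- x<i) → <-asym i<x x<i }))

UsedSet : Set
UsedSet = ℕ → Bool

none : UsedSet
none _ = false

insert : ℕ → UsedSet → UsedSet
insert x u z = (x ≡ᵇ z) ∨ u z

-- x is 0 or a used value: the absolute value of a letter already placed.
Consumed : UsedSet → ℕ → Set
Consumed u x = ∀ j → x ≡ suc j → u (suc j) ≡ true

insert-consumed : ∀ u x → Consumed (insert x u) x
insert-consumed u .(suc j) j refl = cong (_∨ u (suc j)) (to T-≡ (≡⇒≡ᵇ j j refl))

everyBelow : ℕ → (ℕ → Bool) → Bool
everyBelow zero    p = true
everyBelow (suc N) p = p 0 ∧ everyBelow N (p ∘ suc)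

everyBelow-intro : ∀ N p → (∀ j → p j ≡ true) → everyBelow N p ≡ true
everyBelow-intro zero    p all = refl
everyBelow-intro (suc N) p all rewrite all 0 = everyBelow-intro N (p ∘ suc) (all ∘ suc)

everyBelow-elim : ∀ N p → everyBelow N p ≡ true → ∀ j → j < N → p j ≡ true
everyBelow-elim (suc N) p holds j j<N with p 0 in p0
everyBelow-elim (suc N) p holds zero    _         | true = p0
everyBelow-elim (suc N) p holds (suc j) (s≤s j<N) | true = everyBelow-elim N (p ∘ suc) holds j j<N

everyBelow-counterexample : ∀ N p → everyBelow N p ≡ false → ∃[ j ] (j < N × p j ≡ false)
everyBelow-counterexample (suc N) p fails with p 0 in p0
... | false = 0 , s≤s z≤n , p0
... | true with everyBelow-counterexample N (p ∘ suc) fails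
...   | j , j<N , pj = suc j , s≤s j<N , pj

everyBelow-cong : ∀ N {p q} → (∀ j → p j ≡ q j) → everyBelow N p ≡ everyBelow N q
everyBelow-cong zero    p≗q = refl
everyBelow-cong (suc N) p≗q = cong₂ _∧_ (p≗q 0) (everyBelow-cong N (p≗q ∘ suc))

unusedCount : ℕ → UsedSet → ℕ
unusedCount zero    u = 0
unusedCount (suc N) u = (if u 1 then 0 else 1) ℕ.+ unusedCount N (u ∘ suc)

unusedCount-cong : ∀ N {u v : UsedSet} → (∀ j → u (suc j) ≡ v (suc j)) → unusedCount N u ≡ unusedCount N v
unusedCount-cong zero    u≗v = refl
unusedCount-cong (suc N) u≗v =
  cong₂ ℕ._+_ (cong (λ b → if b then 0 else 1) (u≗v 0)) (unusedCount-cong N (u≗v ∘ suc))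

unusedCount-none : ∀ N → unusedCount N none ≡ N
unusedCount-none zero    = refl
unusedCount-none (suc N) = cong suc (unusedCount-none N)

unusedCount-insert : ∀ N u i → i < N → u (suc i) ≡ false →
  unusedCount N u ≡ suc (unusedCount N (insert (suc i) u))
unusedCount-insert (suc N) u zero    _         unused rewrite unused =
  cong suc (unusedCount-cong N (λ j → refl))
unusedCount-insert (suc N) u (suc i) (s≤s i<N) unused =
  trans (cong ((if u 1 then 0 else 1) ℕ.+_) (unusedCount-insert N (u ∘ suc) i i<N unused))
        (+-suc _ _)

belowUnused : ℕ → UsedSet → ℕ → Bool
belowUnused N u x = everyBelow N (λ j → u (suc j) ∨ (x ≤ᵇ suc j))

-- With no unused values left, the condition holds vacuously (stated for an
-- arbitrary second disjunct, so that the induction on N goes through).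
allUsed⇒everyBelow : ∀ N u (q : ℕ → Bool) → unusedCount N u ≡ 0 → everyBelow N (λ j → u (suc j) ∨ q j) ≡ true
allUsed⇒everyBelow zero    u q _ = refl
allUsed⇒everyBelow (suc N) u q count≡0 with u 1
... | true = allUsed⇒everyBelow N (u ∘ suc) (q ∘ suc) count≡0

belowUnused-elim : ∀ N u x i → belowUnused N u x ≡ true → i < N → u (suc i) ≡ false → x ≤ suc i
belowUnused-elim N u x i below i<N unused with everyBelow-elim N _ below i i<N
... | holds rewrite unused = ≤ᵇ⇒≤ x (suc i) (from T-≡ holds)

belowUnused-counterexample : ∀ N u x → belowUnused N u x ≡ false →
  ∃[ j ] (j < N × u (suc j) ≡ false × suc j < x)
belowUnused-counterexample N u x notBelow with everyBelow-counterexample N _ notBelow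
... | j , j<N , fails with u (suc j) in unused
...   | false = j , j<N , unused , ≰⇒> (λ x≤1+j → subst T fails (≤⇒≤ᵇ x≤1+j))

belowUnused-insert : ∀ N u i → belowUnused N (insert (suc i) u) (suc i) ≡ belowUnused N u (suc i)
belowUnused-insert N u i = everyBelow-cong N pointwise
  where
  pointwise : ∀ j → (((suc i ≡ᵇ suc j) ∨ u (suc j)) ∨ (suc i ≤ᵇ suc j)) ≡ (u (suc j) ∨ (suc i ≤ᵇ suc j))
  pointwise j with i ≡ᵇ j in i≡ᵇj
  ... | false = refl
  ... | true  = sym (trans (cong (u (suc j) ∨_) i+1≤ᵇj+1) (∨-zeroʳ (u (suc j))))
    where
    i+1≤ᵇj+1 : (suc i ≤ᵇ suc j) ≡ true
    i+1≤ᵇj+1 = to T-≡ (≤⇒≤ᵇ (s≤s (≤-reflexive (≡ᵇ⇒≡ i j (from T-≡ i≡ᵇj)))))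

isLeastUnused : ℕ → UsedSet → ℕ → Bool
isLeastUnused N u i = not (u (suc i)) ∧ belowUnused N u (suc i)

leastUnused-unique : ∀ N u → 1 ≤ unusedCount N u → sumN N (ind ∘ isLeastUnused N u) ≡ + 1
leastUnused-unique (suc N) u someUnused with u 1
... | false = cong₂ _+_ least othersZero
  where
  least : ind (everyBelow N (λ j → u (suc (suc j)) ∨ true)) ≡ + 1
  least = cong ind (everyBelow-intro N _ (λ j → ∨-zeroʳ (u (suc (suc j)))))
  othersZero : sumN N (λ i → ind (not (u (suc (suc i))) ∧ false)) ≡ + 0
  othersZero = trans (sumN-cong N (λ i _ → cong ind (∧-zeroʳ (not (u (suc (suc i))))))) (sumN-zero N)
... | true = trans (+-identityˡ _) (leastUnused-unique N (u ∘ suc) someUnused)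

avoid-insert : ∀ x u w →
  (allᵇ (λ y → not (x ≡ᵇ ∣ y ∣)) w ∧ allᵇ (λ y → not (u ∣ y ∣)) w) ≡ allᵇ (λ y → not (insert x u ∣ y ∣)) w
avoid-insert x u []      = refl
avoid-insert x u (y ∷ w) with x ≡ᵇ ∣ y ∣ | u ∣ y ∣
... | true  | _     = refl
... | false | true  = ∧-zeroʳ _
... | false | false = avoid-insert x u w

∧-reshuffle : ∀ P D M Q → ((P ∧ D) ∧ (M ∧ Q)) ≡ (M ∧ (D ∧ (P ∧ Q)))
∧-reshuffle P     D false Q = ∧-zeroʳ (P ∧ D)
∧-reshuffle true  D true  Q = refl
∧-reshuffle false D true  Q = sym (∧-zeroʳ D)

admissible : UsedSet → List ℤ → Bool
admissible u w = distinctAbs w ∧ allᵇ (λ y → not (u ∣ y ∣)) w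

admissible-cons : ∀ u b w → admissible u (b ∷ w) ≡ (not (u ∣ b ∣) ∧ admissible (insert ∣ b ∣ u) w)
admissible-cons u b w = begin
  (P ∧ distinctAbs w) ∧ (not (u ∣ b ∣) ∧ Q)       ≡⟨ ∧-reshuffle P (distinctAbs w) (not (u ∣ b ∣)) Q ⟩
  not (u ∣ b ∣) ∧ (distinctAbs w ∧ (P ∧ Q))       ≡⟨ cong (λ z → not (u ∣ b ∣) ∧ (distinctAbs w ∧ z)) (avoid-insert ∣ b ∣ u w) ⟩
  not (u ∣ b ∣) ∧ admissible (insert ∣ b ∣ u) w  ∎
  where
  P Q : Bool
  P = allᵇ (λ y → not (∣ b ∣ ≡ᵇ ∣ y ∣)) w
  Q = allᵇ (λ y → not (u ∣ y ∣)) w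

sign : List ℤ → ℤ
sign w = signOf (isEven (negCount w))

letterSign : ℤ → ℤ
letterSign b = signOf (not (b <ᵇ + 0))

isEven-suc : ∀ m → isEven (suc m) ≡ not (isEven m)
isEven-suc zero          = refl
isEven-suc (suc zero)    = refl
isEven-suc (suc (suc m)) = isEven-suc m

sign-cons : ∀ b w → sign (b ∷ w) ≡ letterSign b * sign w
sign-cons b w with b <ᵇ + 0
... | true  rewrite isEven-suc (negCount w) = signOf-not (isEven (negCount w))
... | false = sym (*-identityˡ (sign w))

descents-cons : ∀ a b w k → ind (descList a (b ∷ w) ≡ᵇ k) ≡ shift (b <ᵇ a) (λ j → ind (descList b w ≡ᵇ j)) k
descents-cons a b w k with b <ᵇ a | k
... | true  | zero  = refl
... | true  | suc k = refl
... | false | k     = refl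

weight : UsedSet → ℤ → ℕ → List ℤ → ℤ
weight u a k w = if admissible u w then sign w * ind (descList a w ≡ᵇ k) else + 0

weight-cons-used : ∀ u a k b w → u ∣ b ∣ ≡ true → weight u a k (b ∷ w) ≡ + 0
weight-cons-used u a k b w used rewrite admissible-cons u b w | used = refl

weight-cons-unused : ∀ u a k b w → u ∣ b ∣ ≡ false →
  weight u a k (b ∷ w) ≡ letterSign b * shift (b <ᵇ a) (λ j → weight (insert ∣ b ∣ u) b j w) k
weight-cons-unused u a k b w unused
  rewrite admissible-cons u b w | unused | sign-cons b w | descents-cons a b w k
  with admissible (insert ∣ b ∣ u) w
... | true  = trans (*-assoc (letterSign b) (sign w) _) (cong (letterSign b *_) (sym (shift-scale (b <ᵇ a) (sign w) _ k)))
... | false = sym (trans (cong (letterSign b *_) (shift-zero (b <ᵇ a) k)) (*-zeroʳ (letterSign b)))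
  where
  shift-zero : ∀ β k → shift β (λ _ → + 0) k ≡ + 0
  shift-zero false k       = refl
  shift-zero true  zero    = refl
  shift-zero true  (suc k) = refl

signedCount : ℕ → UsedSet → ℤ → ℕ → ℕ → ℤ
signedCount n u a m k = sumL (weight u a k) (words m (signedValues n))

firstLetter : ℕ → UsedSet → ℤ → ℕ → ℕ → ℤ → ℤ
firstLetter n u a m k b = if u ∣ b ∣ then + 0 else letterSign b * shift (b <ᵇ a) (signedCount n (insert ∣ b ∣ u) b m) k

wordsStartingWith : ∀ n u a m k b →
  sumL (λ w → weight u a k (b ∷ w)) (words m (signedValues n)) ≡ firstLetter n u a m k b
wordsStartingWith n u a m k b = byUse (u ∣ b ∣) refl
  where
  W : List (List ℤ)
  W = words m (signedValues n)
  byUse : ∀ c → u ∣ b ∣ ≡ c → sumL (λ w → weight u a k (b ∷ w)) W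
    ≡ (if c then + 0 else letterSign b * shift (b <ᵇ a) (signedCount n (insert ∣ b ∣ u) b m) k)
  byUse true  used   = trans (sumL-cong (λ w → weight-cons-used u a k b w used) W) (sumL-zero W)
  byUse false unused = begin
    sumL (λ w → weight u a k (b ∷ w)) W
      ≡⟨ sumL-cong (λ w → weight-cons-unused u a k b w unused) W ⟩
    sumL (λ w → letterSign b * shift (b <ᵇ a) (λ j → weight (insert ∣ b ∣ u) b j w) k) W
      ≡⟨ sumL-scale (letterSign b) _ W ⟩
    letterSign b * sumL (λ w → shift (b <ᵇ a) (λ j → weight (insert ∣ b ∣ u) b j w) k) W
      ≡⟨ cong (letterSign b *_) (shift-sumL (b <ᵇ a) (λ j → weight (insert ∣ b ∣ u) b j) W k) ⟩
    letterSign b * shift (b <ᵇ a) (signedCount n (insert ∣ b ∣ u) b m) k ∎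

pairDifference : ℕ → UsedSet → ℤ → ℕ → ℕ → ℕ → ℤ
pairDifference n u a m k i =
  shift (+ suc i <ᵇ a) (signedCount n (insert (suc i) u) (+ suc i) m) k
    - shift (-[1+ i ] <ᵇ a) (signedCount n (insert (suc i) u) -[1+ i ] m) k

pairContribution : ℕ → UsedSet → ℤ → ℕ → ℕ → ℕ → ℤ
pairContribution n u a m k i = if u (suc i) then + 0 else pairDifference n u a m k i

-- The signs of +(i+1) and −(i+1) are +1 and −1.
letterPair : ∀ n u a m k i →
  firstLetter n u a m k (+ suc i) + (firstLetter n u a m k -[1+ i ] + + 0) ≡ pairContribution n u a m k i
letterPair n u a m k i with u (suc i)
... | true  = refl
... | false = signs (shift (+ suc i <ᵇ a) (signedCount n u' (+ suc i) m) k) (shift (-[1+ i ] <ᵇ a) (signedCount n u' -[1+ i ] m) k)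
  where
  u' : UsedSet
  u' = insert (suc i) u
  signs : ∀ x y → + 1 * x + (-[1+ 0 ] * y + + 0) ≡ x - y
  signs = solve-∀

signedCount-firstLetter : ∀ n u a m k → signedCount n u a (suc m) k ≡ sumN n (pairContribution n u a m k)
signedCount-firstLetter n u a m k = begin
  signedCount n u a (suc m) k
    ≡⟨ sumL-concatMap (weight u a k) (λ b → map (b ∷_) W) (signedValues n) ⟩
  sumL (λ b → sumL (weight u a k) (map (b ∷_) W)) (signedValues n)
    ≡⟨ sumL-cong (λ b → trans (sumL-map (weight u a k) (b ∷_) W) (wordsStartingWith n u a m k b)) (signedValues n) ⟩
  sumL (firstLetter n u a m k) (signedValues n)
    ≡⟨ sumL-concatMap (firstLetter n u a m k) (λ i → + suc i ∷ -[1+ i ] ∷ []) (upTo n) ⟩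
  sumL (λ i → firstLetter n u a m k (+ suc i) + (firstLetter n u a m k -[1+ i ] + + 0)) (upTo n)
    ≡⟨ sumL-applyUpTo _ (λ i → i) n ⟩
  sumN n (λ i → firstLetter n u a m k (+ suc i) + (firstLetter n u a m k -[1+ i ] + + 0))
    ≡⟨ sumN-cong n (λ i _ → letterPair n u a m k i) ⟩
  sumN n (pairContribution n u a m k) ∎
  where W = words m (signedValues n)

SignedDescentSum : ℕ → ℕ → Set
SignedDescentSum n m = ∀ u a k → unusedCount n u ≡ m → Consumed u ∣ a ∣ →
  signedCount n u a m k ≡ ind (belowUnused n u ∣ a ∣) * signedBinomial m k

-- Only the empty word remains, and all values are used.
signedDescentSum-zero : ∀ n → SignedDescentSum n 0
signedDescentSum-zero n u a k count≡0 _ rewrite allUsed⇒everyBelow n u (λ j → ∣ a ∣ ≤ᵇ suc j) count≡0 = emptyWord k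
  where
  emptyWord : ∀ k → + 1 * ind (0 ≡ᵇ k) + + 0 ≡ + 1 * signedBinomial 0 k
  emptyWord zero    = refl
  emptyWord (suc k) = sym (cong (+ 1 *_) (*-zeroʳ (-[1+ 0 ] ^ suc k)))

pairContribution-used : ∀ n u a m k i → u (suc i) ≡ true → pairContribution n u a m k i ≡ + 0
pairContribution-used n u a m k i used = cong (λ c → if c then + 0 else pairDifference n u a m k i) used

pairContribution-unused : ∀ {n m} → SignedDescentSum n m → ∀ u a k i → i < n → u (suc i) ≡ false →
  unusedCount n u ≡ suc m →
  pairContribution n u a m k i ≡ ind (belowUnused n u (suc i)) * descentDiff (+ suc i <ᵇ a) (-[1+ i ] <ᵇ a) (signedBinomial m) k
pairContribution-unused {n} {m} ih u a k i i<n unused count≡ = begin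
  pairContribution n u a m k i
    ≡⟨ cong (λ c → if c then + 0 else pairDifference n u a m k i) unused ⟩
  shift β⁺ (signedCount n u' (+ suc i) m) k - shift β⁻ (signedCount n u' -[1+ i ] m) k
    ≡⟨ cong₂ _-_ (shift-cong β⁺ (remainder (+ suc i) refl) k) (shift-cong β⁻ (remainder -[1+ i ] refl) k) ⟩
  shift β⁺ (λ j → L * signedBinomial m j) k - shift β⁻ (λ j → L * signedBinomial m j) k
    ≡⟨ descentDiff-scale β⁺ β⁻ L (signedBinomial m) k ⟩
  L * descentDiff β⁺ β⁻ (signedBinomial m) k ∎
  where
  u' : UsedSet
  u' = insert (suc i) u
  β⁺ β⁻ : Bool
  β⁺ = + suc i <ᵇ a
  β⁻ = -[1+ i ] <ᵇ a
  L : ℤ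
  L = ind (belowUnused n u (suc i))
  remainder : ∀ b → ∣ b ∣ ≡ suc i → ∀ j → signedCount n u' b m j ≡ L * signedBinomial m j
  remainder b ∣b∣≡i+1 j = begin
    signedCount n u' b m j
      ≡⟨ ih u' b j count' (subst (Consumed u') (sym ∣b∣≡i+1) (insert-consumed u (suc i))) ⟩
    ind (belowUnused n u' ∣ b ∣) * signedBinomial m j
      ≡⟨ cong (λ z → ind z * signedBinomial m j) (trans (cong (belowUnused n u') ∣b∣≡i+1) (belowUnused-insert n u i)) ⟩
    L * signedBinomial m j ∎
    where
    count' : unusedCount n u' ≡ m
    count' = suc-injective (trans (sym (unusedCount-insert n u i i<n unused)) count≡)

below⇒ascentDescent : ∀ n u a i → Consumed u ∣ a ∣ → belowUnused n u ∣ a ∣ ≡ true → i < n → u (suc i) ≡ false →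
  (+ suc i <ᵇ a) ≡ false × (-[1+ i ] <ᵇ a) ≡ true
below⇒ascentDescent n u a i consumed below i<n unused = ascentDescent a i (≤∧≢⇒< a≤i+1 a≢i+1)
  where
  a≤i+1 : ∣ a ∣ ≤ suc i
  a≤i+1 = belowUnused-elim n u ∣ a ∣ i below i<n unused
  a≢i+1 : ¬ (∣ a ∣ ≡ suc i)
  a≢i+1 a≡i+1 = subst T (trans (sym (consumed i a≡i+1)) unused) _

-- If |a| is below every unused value, only the least unused value j contributes,
-- and since |a| < j it yields Pascal's rule.
sumOfPairs-below : ∀ {n m} → SignedDescentSum n m → ∀ u a k → unusedCount n u ≡ suc m → Consumed u ∣ a ∣ →
  belowUnused n u ∣ a ∣ ≡ true → sumN n (pairContribution n u a m k) ≡ signedBinomial (suc m) k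
sumOfPairs-below {n} {m} ih u a k count≡ consumed below = begin
  sumN n (pairContribution n u a m k)                ≡⟨ sumN-cong n pair ⟩
  sumN n (λ i → ind (isLeastUnused n u i) * X)      ≡⟨ sumN-scale n (ind ∘ isLeastUnused n u) X ⟩
  sumN n (ind ∘ isLeastUnused n u) * X               ≡⟨ cong (_* X) (leastUnused-unique n u someUnused) ⟩
  + 1 * X                                            ≡⟨ *-identityˡ X ⟩
  X                                                  ∎
  where
  X : ℤ
  X = signedBinomial (suc m) k
  someUnused : 1 ≤ unusedCount n u
  someUnused = subst (1 ≤_) (sym count≡) (s≤s z≤n)
  pair : ∀ i → i < n → pairContribution n u a m k i ≡ ind (isLeastUnused n u i) * X
  pair i i<n = boolCases (u (suc i))
    (λ used → trans (pairContribution-used n u a m k i used) (cong (λ c → ind (not c ∧ L) * X) (sym used)))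
    (λ unused → begin
      pairContribution n u a m k i
        ≡⟨ pairContribution-unused ih u a k i i<n unused count≡ ⟩
      ind L * descentDiff (+ suc i <ᵇ a) (-[1+ i ] <ᵇ a) (signedBinomial m) k
        ≡⟨ cong₂ (λ β⁺ β⁻ → ind L * descentDiff β⁺ β⁻ (signedBinomial m) k) (ascent unused) (descent unused) ⟩
      ind L * descentDiff false true (signedBinomial m) k
        ≡⟨ cong (ind L *_) (signedPascal m k) ⟩
      ind L * X
        ≡⟨ cong (λ c → ind (not c ∧ L) * X) (sym unused) ⟩
      ind (isLeastUnused n u i) * X ∎)
    where
    L : Bool
    L = belowUnused n u (suc i)
    ascent : u (suc i) ≡ false → (+ suc i <ᵇ a) ≡ false
    ascent unused = proj₁ (below⇒ascentDescent n u a i consumed below i<n unused)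
    descent : u (suc i) ≡ false → (-[1+ i ] <ᵇ a) ≡ true
    descent unused = proj₂ (below⇒ascentDescent n u a i consumed below i<n unused)

-- If some unused value j₀ lies below |a|, every pair cancels: for the least unused
-- value j ≤ j₀ < |a| both letters compare alike with a, the others give 0.
sumOfPairs-above : ∀ {n m} → SignedDescentSum n m → ∀ u a k → unusedCount n u ≡ suc m →
  belowUnused n u ∣ a ∣ ≡ false → sumN n (pairContribution n u a m k) ≡ + 0
sumOfPairs-above {n} {m} ih u a k count≡ notBelow with belowUnused-counterexample n u ∣ a ∣ notBelow
... | j₀ , j₀<n , j₀-unused , j₀<a = trans (sumN-cong n pair) (sumN-zero n)
  where
  pair : ∀ i → i < n → pairContribution n u a m k i ≡ + 0
  pair i i<n = boolCases (u (suc i))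
    (pairContribution-used n u a m k i)
    (λ unused → trans (pairContribution-unused ih u a k i i<n unused count≡) (cancel (belowUnused n u (suc i)) refl))
    where
    cancel : ∀ L → belowUnused n u (suc i) ≡ L →
      ind L * descentDiff (+ suc i <ᵇ a) (-[1+ i ] <ᵇ a) (signedBinomial m) k ≡ + 0
    cancel false _     = refl
    cancel true  least = begin
      + 1 * descentDiff (+ suc i <ᵇ a) (-[1+ i ] <ᵇ a) (signedBinomial m) k
        ≡⟨ cong (λ β → + 1 * descentDiff β (-[1+ i ] <ᵇ a) (signedBinomial m) k) (sameSide a i i<a) ⟩
      + 1 * descentDiff (-[1+ i ] <ᵇ a) (-[1+ i ] <ᵇ a) (signedBinomial m) k
        ≡⟨ cong (+ 1 *_) (descentDiff-same (-[1+ i ] <ᵇ a) (signedBinomial m) k) ⟩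
      + 0 ∎
      where
      i<a : suc i < ∣ a ∣
      i<a = ≤-<-trans (belowUnused-elim n u (suc i) j₀ least j₀<n j₀-unused) j₀<a

signedDescentSum-suc : ∀ {n m} → SignedDescentSum n m → SignedDescentSum n (suc m)
signedDescentSum-suc {n} {m} ih u a k count≡ consumed =
  trans (signedCount-firstLetter n u a m k) (byPosition (belowUnused n u ∣ a ∣) refl)
  where
  byPosition : ∀ L → belowUnused n u ∣ a ∣ ≡ L →
    sumN n (pairContribution n u a m k) ≡ ind L * signedBinomial (suc m) k
  byPosition true  below    = trans (sumOfPairs-below {n} ih u a k count≡ consumed below) (sym (*-identityˡ _))
  byPosition false notBelow = sumOfPairs-above {n} ih u a k count≡ notBelow

signedDescentSum : ∀ n m → SignedDescentSum n m
signedDescentSum n zero    = signedDescentSum-zero n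
signedDescentSum n (suc m) = signedDescentSum-suc {n} (signedDescentSum n m)

-- Over Bₙ (all letters unused, preceded by 0) the summand is the weight.
nothingUsed : ∀ (w : List ℤ) → allᵇ (λ y → not (none ∣ y ∣)) w ≡ true
nothingUsed []      = refl
nothingUsed (x ∷ w) = nothingUsed w

fullWeight : ∀ k σ → (if distinctAbs σ then sign σ * ind (desc σ ≡ᵇ k) else + 0) ≡ weight none (+ 0) k σ
fullWeight k σ with distinctAbs σ
... | false = refl
... | true rewrite nothingUsed σ = refl

proposition4p3 : (n k : ℕ) → k ≤ n →
    (+ Dcount n k) - (+ Dtcount n k) ≡ (-[1+ 0 ] ^ k) * (+ (n C k))
proposition4p3 n k _ = begin
  + Dcount n k - + Dtcount n k
    ≡⟨ countDifference (isEven ∘ negCount) (λ σ → desc σ ≡ᵇ k) (B n) ⟩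
  sumL (λ σ → sign σ * ind (desc σ ≡ᵇ k)) (B n)
    ≡⟨ sumL-filter _ distinctAbs (words n (signedValues n)) ⟩
  sumL (λ σ → if distinctAbs σ then sign σ * ind (desc σ ≡ᵇ k) else + 0) (words n (signedValues n))
    ≡⟨ sumL-cong (fullWeight k) (words n (signedValues n)) ⟩
  signedCount n none (+ 0) n k
    ≡⟨ signedDescentSum n n none (+ 0) k (unusedCount-none n) (λ j ()) ⟩
  ind (belowUnused n none 0) * signedBinomial n k
    ≡⟨ cong (λ L → ind L * signedBinomial n k) (everyBelow-intro n _ (λ j → refl)) ⟩
  + 1 * signedBinomial n k
    ≡⟨ *-identityˡ _ ⟩
  signedBinomial n k ∎
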